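{- For every rational number $r$ with $\tfrac12<r<1$, there exists $u\in\mathbb{N}$ such that $\frac{s_4(u^2)}{s_4(u)}=r$.
   Context: $s_4(n)$ denotes the sum of the digits of $n$ in base $4$. -}

module Defs where

open import Data.Nat using (ℕ; zero; suc; _+_; _/_; _%_)
open import Data.Nat.DivMod

-- s₄ n : sum of the base-4 digits of n.
-- Auxiliary with a fuel argument (fuel ≥ n suffices since n/4 < n for n > 0).
s4-aux : ℕ → ℕ → ℕ
s4-aux zero    n = 0
s4-aux (suc k) zero = 0
s4-aux (suc k) n@(suc _) = n % 4 + s4-aux k (n / 4)

s4 : ℕ → ℕ
s4 n = s4-aux n n

module Submission where

-- Write r = p/q in lowest terms with p < q < 2p, and set x = q − p and
-- z = p − x − 1, so x ≥ 1 and z ≥ 0.  Writing 3ⁿ for a block of n digits 3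
-- (the number 4ⁿ − 1), the integer with base-4 digits
--        u = 1 2 3^(x−1) 3^p
-- has s₄(u) = 3(x + p) = 3q, and its square is the concatenation of
--        3^x 0^(p−z) 3^z 0^x 2 0^(p−1) 1,
-- so s₄(u²) = 3(x + z + 1) = 3p; hence s₄(u²)/s₄(u) = 3p/3q = r.

module DigitSum where

  open import Defs

  open import Data.Nat
  open import Data.Nat.Properties
  open import Data.Nat.DivMod
  open import Data.Nat.Divisibility using (divides-refl)
  open import Relation.Binary.PropositionalEquality
  open import Data.Nat.Tactic.RingSolver using (solve-∀)
  open ≡-Reasoning

  quarter-≤ : ∀ n k → suc n ≤ suc k → suc n / 4 ≤ k
  quarter-≤ n k n<k = ≤-pred (≤-trans (m/n<m (suc n) 4 (s≤s (s≤s z≤n))) n<k)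

  s4-aux-fuel : ∀ j k n → n ≤ j → n ≤ k → s4-aux j n ≡ s4-aux k n
  s4-aux-fuel zero    zero    zero    _    _    = refl
  s4-aux-fuel zero    (suc k) zero    _    _    = refl
  s4-aux-fuel (suc j) zero    zero    _    _    = refl
  s4-aux-fuel (suc j) (suc k) zero    _    _    = refl
  s4-aux-fuel (suc j) (suc k) (suc n) n≤j n≤k =
    cong (suc n % 4 +_) (s4-aux-fuel j k (suc n / 4) (quarter-≤ n j n≤j) (quarter-≤ n k n≤k))

  s4-step : ∀ n → s4 n ≡ n % 4 + s4 (n / 4)
  s4-step zero    = refl
  s4-step (suc n) = cong (suc n % 4 +_)
    (s4-aux-fuel n (suc n / 4) (suc n / 4) (quarter-≤ n n ≤-refl) ≤-refl)

  s4-digit : ∀ d m → d < 4 → s4 (d + m * 4) ≡ d + s4 m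
  s4-digit d m d<4 = begin
      s4 (d + m * 4)
    ≡⟨ s4-step (d + m * 4) ⟩
      (d + m * 4) % 4 + s4 ((d + m * 4) / 4)
    ≡⟨ cong₂ (λ i j → i + s4 j) last-digit rest ⟩
      d + s4 m ∎
    where
    last-digit : (d + m * 4) % 4 ≡ d
    last-digit = trans ([m+kn]%n≡m%n d m 4) (m<n⇒m%n≡m d<4)
    rest : (d + m * 4) / 4 ≡ m
    rest = trans (+-distrib-/-∣ʳ d (divides-refl m))
                 (cong₂ _+_ (m<n⇒m/n≡0 d<4) (m*n/n≡m m 4))

  s4-concat : ∀ n a b → b < 4 ^ n → s4 (a * 4 ^ n + b) ≡ s4 a + s4 b
  s4-concat zero a zero _ = begin
      s4 (a * 1 + 0)  ≡⟨ cong s4 (trans (+-identityʳ _) (*-identityʳ a)) ⟩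
      s4 a            ≡⟨ +-identityʳ (s4 a) ⟨
      s4 a + 0        ∎
  s4-concat zero a (suc b) (s≤s ())
  s4-concat (suc n) a b b<4ⁿ⁺¹ = begin
      s4 (a * 4 ^ suc n + b)
    ≡⟨ cong s4 peel-last-digit ⟩
      s4 (b % 4 + (a * 4 ^ n + b / 4) * 4)
    ≡⟨ s4-digit (b % 4) (a * 4 ^ n + b / 4) (m%n<n b 4) ⟩
      b % 4 + s4 (a * 4 ^ n + b / 4)
    ≡⟨ cong (b % 4 +_) (s4-concat n a (b / 4) b/4<4ⁿ) ⟩
      b % 4 + (s4 a + s4 (b / 4))
    ≡⟨ +-assoc-comm (b % 4) (s4 a) (s4 (b / 4)) ⟩
      s4 a + (b % 4 + s4 (b / 4))
    ≡⟨ cong (s4 a +_) (s4-step b) ⟨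
      s4 a + s4 b ∎
    where
    +-assoc-comm : ∀ x y w → x + (y + w) ≡ y + (x + w)
    +-assoc-comm = solve-∀
    regroup : ∀ a P r s → a * (4 * P) + (r + s * 4) ≡ r + (a * P + s) * 4
    regroup = solve-∀
    peel-last-digit : a * 4 ^ suc n + b ≡ b % 4 + (a * 4 ^ n + b / 4) * 4
    peel-last-digit = trans (cong (a * 4 ^ suc n +_) (m≡m%n+[m/n]*n b 4))
                            (regroup a (4 ^ n) (b % 4) (b / 4))
    b/4<4ⁿ : b / 4 < 4 ^ n
    b/4<4ⁿ = m<n*o⇒m/o<n (subst (b <_) (*-comm 4 (4 ^ n)) b<4ⁿ⁺¹)

  threes : ℕ → ℕ
  threes zero    = 0
  threes (suc n) = 3 + threes n * 4

  s4-threes : ∀ n → s4 (threes n) ≡ 3 * n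
  s4-threes zero    = refl
  s4-threes (suc n) = begin
      s4 (3 + threes n * 4)  ≡⟨ s4-digit 3 (threes n) (s≤s (s≤s (s≤s (s≤s z≤n)))) ⟩
      3 + s4 (threes n)      ≡⟨ cong (3 +_) (s4-threes n) ⟩
      3 + 3 * n              ≡⟨ *-suc 3 n ⟨
      3 * suc n              ∎

  1+threes : ∀ n → suc (threes n) ≡ 4 ^ n
  1+threes zero    = refl
  1+threes (suc n) = trans (times-4 (threes n)) (cong (4 *_) (1+threes n))
    where
    times-4 : ∀ t → suc (3 + t * 4) ≡ 4 * suc t
    times-4 = solve-∀

  threes<4^ : ∀ n → threes n < 4 ^ n
  threes<4^ n = ≤-reflexive (1+threes n)

module Witness where

  open import Defs
  open import Data.Nat
  open import Data.Nat.Properties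
  open import Relation.Binary.PropositionalEquality
  open import Data.Nat.Tactic.RingSolver using (solve-∀)
  open ≡-Reasoning
  open DigitSum

  -- The witness is parametrised by x' = x − 1 ≥ 0 and z ≥ 0, where
  -- p = x + 1 + z is its numerator parameter.

  -- The leading block, with base-4 digits 1 2 3^(x−1); it equals 2·4ˣ − 2.
  leading : ℕ → ℕ
  leading x' = 4 ^ suc x' + (2 + threes x' * 4)

  witness : ℕ → ℕ → ℕ
  witness x' z = leading x' * 4 ^ p + threes p
    where p = suc (suc x') + z

  s4-leading : ∀ x' → s4 (leading x') ≡ 3 * suc x'
  s4-leading x' = begin
      s4 (leading x')
    ≡⟨ cong (λ v → s4 (v + tail)) (*-identityˡ (4 ^ suc x')) ⟨
      s4 (1 * 4 ^ suc x' + tail)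
    ≡⟨ s4-concat (suc x') 1 tail tail<4ˣ ⟩
      1 + s4 (2 + threes x' * 4)
    ≡⟨ cong (1 +_) (s4-digit 2 (threes x') (s≤s (s≤s (s≤s z≤n)))) ⟩
      1 + (2 + s4 (threes x'))
    ≡⟨ cong (λ v → 3 + v) (s4-threes x') ⟩
      3 + 3 * x'
    ≡⟨ *-suc 3 x' ⟨
      3 * suc x' ∎
    where
    tail = 2 + threes x' * 4
    tail<4ˣ : tail < 4 ^ suc x'
    tail<4ˣ = subst (tail <_) (1+threes (suc x')) (m<n⇒m<1+n (n<1+n tail))

  s4-witness : ∀ x' z → s4 (witness x' z) ≡ 3 * (suc x' + suc (suc x' + z))
  s4-witness x' z = begin
      s4 (leading x' * 4 ^ p + threes p)
    ≡⟨ s4-concat p (leading x') (threes p) (threes<4^ p) ⟩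
      s4 (leading x') + s4 (threes p)
    ≡⟨ cong₂ _+_ (s4-leading x') (s4-threes p) ⟩
      3 * suc x' + 3 * p
    ≡⟨ *-distribˡ-+ 3 (suc x') p ⟨
      3 * (suc x' + p) ∎
    where p = suc (suc x') + z

  -- The square of u as a polynomial identity, in terms of a = 3^(x−1) and
  -- c = 3^z: then 4ˣ = 4(a+1), 4^p = 4·4ˣ(c+1), 3^p = 4^p − 1, and
  -- 4^(x+p+1) = 4ˣ·4·4^p.  It exhibits u² as the concatenation of
  -- 3ˣ·4^p + 3^z (the digits 3^x 0^(p−z) 3^z) with 2·4^p + 1.
  square-identity : ∀ a c X Y T F →
    X ≡ 4 * suc a → Y ≡ 4 * (X * suc c) →
    T ≡ 15 + 16 * a + 16 * c + 16 * (a * c) → F ≡ X * (4 * Y) →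
    ((X + (2 + a * 4)) * Y + T) * ((X + (2 + a * 4)) * Y + T)
      ≡ ((3 + a * 4) * Y + c) * F + (2 * Y + 1)
  square-identity a c _ _ _ _ refl refl refl refl = polynomial a c
    where
    polynomial : ∀ a c →
      let X = 4 * suc a ; Y = 4 * (X * suc c) in
      ((X + (2 + a * 4)) * Y + (15 + 16 * a + 16 * c + 16 * (a * c)))
        * ((X + (2 + a * 4)) * Y + (15 + 16 * a + 16 * c + 16 * (a * c)))
        ≡ ((3 + a * 4) * Y + c) * (X * (4 * Y)) + (2 * Y + 1)
    polynomial = solve-∀

  2Y+1<4Y : ∀ Y → 0 < Y → 2 * Y + 1 < 4 * Y
  2Y+1<4Y (suc r) _ = subst (suc (2 * suc r + 1) ≤_) (sym (split r)) (m≤m+n _ (2 * r))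
    where
    split : ∀ r → 4 * suc r ≡ suc (2 * suc r + 1) + 2 * r
    split = solve-∀

  s4-witness² : ∀ x' z → s4 (witness x' z * witness x' z) ≡ 3 * suc (suc x' + z)
  s4-witness² x' z = begin
      s4 (witness x' z * witness x' z)
    ≡⟨ cong s4 (square-identity a c (4 ^ x) (4 ^ p) (threes p) (4 ^ E) 4ˣ 4ᵖ 3ᵖ 4ᴱ) ⟩
      s4 (high * 4 ^ E + low)
    ≡⟨ s4-concat E high low low<4ᴱ ⟩
      s4 high + s4 low
    ≡⟨ cong₂ _+_ (s4-concat p (threes x) c c<4ᵖ) (s4-concat p 2 1 1<4ᵖ) ⟩
      (s4 (threes x) + s4 c) + 3
    ≡⟨ cong₂ (λ i j → (i + j) + 3) (s4-threes x) (s4-threes z) ⟩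
      (3 * x + 3 * z) + 3
    ≡⟨ collect x z ⟩
      3 * suc (x + z) ∎
    where
    a = threes x'
    c = threes z
    x = suc x'
    p = suc x + z
    E = x + suc p
    high = threes x * 4 ^ p + c
    low = 2 * 4 ^ p + 1
    collect : ∀ x z → (3 * x + 3 * z) + 3 ≡ 3 * suc (x + z)
    collect = solve-∀
    4ˣ : 4 ^ x ≡ 4 * suc a
    4ˣ = cong (4 *_) (sym (1+threes x'))
    4ᵖ : 4 ^ p ≡ 4 * (4 ^ x * suc c)
    4ᵖ = cong (4 *_) (trans (^-distribˡ-+-* 4 x z) (cong (4 ^ x *_) (sym (1+threes z))))
    3ᵖ : threes p ≡ 15 + 16 * a + 16 * c + 16 * (a * c)
    3ᵖ = suc-injective (begin
        suc (threes p)           ≡⟨ 1+threes p ⟩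
        4 ^ p                    ≡⟨ 4ᵖ ⟩
        4 * (4 ^ x * suc c)      ≡⟨ cong (λ v → 4 * (v * suc c)) 4ˣ ⟩
        4 * (4 * suc a * suc c)  ≡⟨ expand a c ⟩
        suc (15 + 16 * a + 16 * c + 16 * (a * c)) ∎)
      where
      expand : ∀ a c → 4 * (4 * suc a * suc c) ≡ suc (15 + 16 * a + 16 * c + 16 * (a * c))
      expand = solve-∀
    4ᴱ : 4 ^ E ≡ 4 ^ x * (4 * 4 ^ p)
    4ᴱ = ^-distribˡ-+-* 4 x (suc p)
    c<4ᵖ : c < 4 ^ p
    c<4ᵖ = <-≤-trans (threes<4^ z) (^-monoʳ-≤ 4 (m≤n+m z (suc x)))
    1<4ᵖ : 1 < 4 ^ p
    1<4ᵖ = subst (1 <_) (1+threes p) (s≤s (s≤s z≤n))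
    low<4ᴱ : low < 4 ^ E
    low<4ᴱ = <-≤-trans (2Y+1<4Y (4 ^ p) (m^n>0 4 p)) (^-monoʳ-≤ 4 (m≤n+m (suc p) x))

module Fractions where

  open import Data.Nat
  open import Data.Nat.Properties
  open import Data.Nat.Coprimality using (Coprime)
  open import Data.Integer as ℤ using (+_)
  open import Data.Integer.Properties as ℤ using (pos-*)
  open import Data.Rational as ℚ using (ℚ; mkℚ; ½; 1ℚ; *<*; fromℚᵘ)
  open import Data.Rational.Properties using (fromℚᵘ-toℚᵘ; fromℚᵘ-cong)
  open import Data.Rational.Unnormalised as ℚᵘ using ()
  open import Data.Rational.Unnormalised.Properties using (*-cancelˡ-/)
  open import Data.Product using (Σ; ∃₂; _×_; _,_)
  open import Relation.Binary.PropositionalEquality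
  open import Data.Nat.Tactic.RingSolver using (solve-∀)

  pos-*-< : ∀ m n k l → + m ℤ.* + n ℤ.< + k ℤ.* + l → m * n < k * l
  pos-*-< m n k l lt rewrite sym (pos-* m n) | sym (pos-* k l) = ℤ.drop‿+<+ lt

  between-½-and-1 : ∀ p d .(c : Coprime p (suc d)) →
    ½ ℚ.< mkℚ (+ p) d c → mkℚ (+ p) d c ℚ.< 1ℚ → suc d < 2 * p × p < suc d
  between-½-and-1 p d c (*<* ½<r) (*<* r<1) =
      subst₂ _<_ (*-identityˡ (suc d)) (*-comm p 2) (pos-*-< 1 (suc d) p 2 ½<r)
    , subst₂ _<_ (*-identityʳ p) (*-identityˡ (suc d)) (pos-*-< p 1 1 (suc d) r<1)

  split-between : ∀ p q → q < 2 * p → p < q →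
    ∃₂ λ x' z → p ≡ suc (suc x') + z × q ≡ suc x' + p
  split-between p q q<2p p<q with m≤n⇒∃[o]m+o≡n p<q
  ... | x' , refl with m≤n⇒∃[o]m+o≡n x<p
    where
    x<p : suc (suc x') ≤ p
    x<p = +-cancelˡ-≤ p (suc (suc x')) p
      (subst₂ _≤_ (shift p x') (twice p) q<2p)
      where
      shift : ∀ p x' → suc (suc (p + x')) ≡ p + suc (suc x')
      shift = solve-∀
      twice : ∀ p → 2 * p ≡ p + p
      twice = solve-∀
  ... | z , refl = x' , z , refl , cong suc (+-comm (suc (suc x') + z) x')

  triple : ∀ p d .(c : Coprime p (suc d)) → mkℚ (+ p) d c ≡ + (3 * p) ℚ./ (3 * suc d)
  triple p d c = begin
      mkℚ (+ p) d c
    ≡⟨ fromℚᵘ-toℚᵘ (mkℚ (+ p) d c) ⟨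
      fromℚᵘ (+ p ℚᵘ./ suc d)
    ≡⟨ fromℚᵘ-cong (*-cancelˡ-/ 3 {+ p} {suc d}) ⟨
      fromℚᵘ ((+ 3 ℤ.* + p) ℚᵘ./ (3 * suc d))
    ≡⟨ cong (ℚ._/ (3 * suc d)) (pos-* 3 p) ⟨
      + (3 * p) ℚ./ (3 * suc d) ∎
    where open ≡-Reasoning

  as-fraction : ∀ (r : ℚ) a b m n {{_ : NonZero n}} → r ≡ + m ℚ./ n → a ≡ m → b ≡ n →
    Σ (NonZero b) λ nz → r ≡ (+ a ℚ./ b) {{nz}}
  as-fraction r a b m n {{nz}} eq refl refl = nz , eq

open import Defs
open import Data.Nat using (ℕ; suc; NonZero; _*_)
open import Data.Integer using (+_; -[1+_])
open import Data.Rational using (ℚ; _<_; _/_; ½; 1ℚ; mkℚ; *<*)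
open import Data.Product using (Σ; ∃; _,_)
open import Relation.Binary.PropositionalEquality using (_≡_; refl; sym; trans; cong)
open Witness using (witness; s4-witness; s4-witness²)
open Fractions using (between-½-and-1; split-between; triple; as-fraction)

lemma3p9 : (r : ℚ) → ½ < r → r < 1ℚ →
    ∃ λ (u : ℕ) → Σ (NonZero (s4 u)) λ nz → r ≡ (+ s4 (u * u) / s4 u) {{nz}}
lemma3p9 (mkℚ -[1+ _ ] _ _) (*<* ()) _
lemma3p9 r@(mkℚ (+ p) d c) ½<r r<1
  with between-½-and-1 p d c ½<r r<1
... | q<2p , p<q with split-between p (suc d) q<2p p<q
... | x' , z , refl , q≡x+p =
  witness x' z ,
  as-fraction r _ _ (3 * p) (3 * suc d) (triple p d c)
    (s4-witness² x' z)
    (trans (s4-witness x' z) (cong (3 *_) (sym q≡x+p)))
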